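{- Let $Y_1$ be a Steiner triple system that is $PG(3,2)$-2-pointed (with respect to some pair of points) and satisfies $|Y_1| \equiv 7 \pmod 8$. Let $k \geq 4$ and let $Y := Y_1 \times PG(k-1,2)$. Then (i) $|Y| \equiv 1 \pmod 8$, and (ii) both $Y_1$ and $Y$ are $PG(2,2)$-paired.
   Context: A Steiner triple system (STS) is a finite set of points with 3-element subsets (triples) such that any two distinct points lie in exactly one triple; $|Y|$ is its number of points. A subsystem is a subset closed under completing triples; the subsystem generated by a set of points is the smallest subsystem containing it. A $PG(k,2)$ subsystem is a subsystem isomorphic to the STS of points and lines of $PG(k,2)$; $PG(k-1,2)$ also denotes this STS. An STS with more than seven points is $PG(3,2)$-2-pointed with respect to two points if any four points including these two generate a $PG(k,2)$ subsystem for $k=2$ or $3$. An STS is $PG(2,2)$-paired if any two points lie in at least two $PG(2,2)$ subsystems. The direct product $A \times B$ of STSs $A,B$ has point set $A \times B$ and triples $\{(a,b_1),(a,b_2),(a,b_3)\}$ and $\{(a_1,b),(a_2,b),(a_3,b)\}$ and $\{(a_1,b_1),(a_2,b_2),(a_3,b_3)\}$, where $a \in A$, $b \in B$, $\{a_1,a_2,a_3\}$ is a triple of $A$ and $\{b_1,b_2,b_3\}$ is a triple of $B$ (with the points taken in any order). -}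

module Defs where

open import Level using (0ℓ)
open import Data.Nat using (ℕ; suc; _<_; _%_)
open import Data.Fin using (Fin)
open import Data.Bool using (Bool; true; false; _∨_; _xor_; T)
open import Data.Vec using (Vec; foldr; zipWith)
open import Data.Product using (Σ; ∃; ∃-syntax; _×_; _,_; proj₁)
open import Data.Sum using (_⊎_)
open import Relation.Nullary using (¬_)
open import Relation.Unary using (Pred; _⊆_)
open import Relation.Binary.PropositionalEquality using (_≡_; _≢_)
open import Function.Bundles using (_↔_; _⇔_)

-- Triples of an STS are unordered 3-sets; we encode "{a,b,c} is a triple"
-- by the predicate Tri a b c, required (in IsSTS) to be permutation invariant.
record TS : Set₁ where
  field
    Pt  : Set
    Tri : Pt → Pt → Pt → Set
open TS public

HasSize : TS → ℕ → Set
HasSize Y n = Pt Y ↔ Fin n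

record IsSTS (Y : TS) : Set where
  field
    finite   : ∃[ n ] HasSize Y n
    swap₁₂   : ∀ a b c → Tri Y a b c → Tri Y b a c
    swap₂₃   : ∀ a b c → Tri Y a b c → Tri Y a c b
    distinct : ∀ a b c → Tri Y a b c → a ≢ b
    third    : ∀ a b → a ≢ b → ∃[ c ] Tri Y a b c
    unique   : ∀ a b c c′ → Tri Y a b c → Tri Y a b c′ → c ≡ c′

IsSubsystem : (Y : TS) → Pred (Pt Y) 0ℓ → Set
IsSubsystem Y S = ∀ a b c → S a → S b → Tri Y a b c → S c

GeneratedBy : (Y : TS) → Pred (Pt Y) 0ℓ → Pred (Pt Y) 0ℓ → Set₁
GeneratedBy Y A S =
  IsSubsystem Y S × A ⊆ S × (∀ (S′ : Pred (Pt Y) 0ℓ) → IsSubsystem Y S′ → A ⊆ S′ → S ⊆ S′)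

-- Projective geometry over GF(2), indexed by the VECTOR dimension d:
-- PGV d is the STS PG(d-1,2): points = nonzero vectors of GF(2)^d,
-- triples = {x, y, x+y} with x ≠ y.
anyTrue : ∀ {d} → Vec Bool d → Bool
anyTrue = foldr _ _∨_ false

PGPt : ℕ → Set
PGPt d = Σ (Vec Bool d) (λ v → T (anyTrue v))

PGTri : ∀ d → PGPt d → PGPt d → PGPt d → Set
PGTri d p q r = (proj₁ p ≢ proj₁ q) × (zipWith _xor_ (proj₁ p) (proj₁ q) ≡ proj₁ r)

PGV : ℕ → TS
PGV d = record { Pt = PGPt d ; Tri = PGTri d }

PG : ℕ → TS
PG k = PGV (suc k)

IsoPG : (Y : TS) → Pred (Pt Y) 0ℓ → ℕ → Set
IsoPG Y S k =
  Σ (Pt (PG k) → Pt Y) λ g →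
    (∀ p q → g p ≡ g q → p ≡ q) ×
    (∀ x → S x ⇔ (∃[ p ] g p ≡ x)) ×
    (∀ p q r → Tri (PG k) p q r ⇔ Tri Y (g p) (g q) (g r))

IsPGSubsystem : (Y : TS) → Pred (Pt Y) 0ℓ → ℕ → Set
IsPGSubsystem Y S k = IsSubsystem Y S × IsoPG Y S k

Four : {P : Set} → P → P → P → P → Pred P 0ℓ
Four x y u v z = z ≡ x ⊎ z ≡ y ⊎ z ≡ u ⊎ z ≡ v

GeneratesPG : (Y : TS) → Pred (Pt Y) 0ℓ → ℕ → Set₁
GeneratesPG Y A k = ∃[ S ] (GeneratedBy Y A S × IsPGSubsystem Y S k)

PG32TwoPointedWrt : (Y : TS) → Pt Y → Pt Y → Set₁
PG32TwoPointedWrt Y x y =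
  (∃[ n ] (HasSize Y n × 7 < n)) ×
  x ≢ y ×
  (∀ u v → u ≢ x → u ≢ y → v ≢ x → v ≢ y → u ≢ v →
     GeneratesPG Y (Four x y u v) 2 ⊎ GeneratesPG Y (Four x y u v) 3)

PG22Paired : TS → Set₁
PG22Paired Y =
  ∀ a b → a ≢ b →
    ∃[ S₁ ] ∃[ S₂ ]
      (IsPGSubsystem Y S₁ 2 × IsPGSubsystem Y S₂ 2 ×
       S₁ a × S₁ b × S₂ a × S₂ b ×
       ∃[ z ] ((S₁ z × ¬ S₂ z) ⊎ (S₂ z × ¬ S₁ z)))

_⊗_ : TS → TS → TS
A ⊗ B = record
  { Pt  = Pt A × Pt B
  ; Tri = λ { (a₁ , b₁) (a₂ , b₂) (a₃ , b₃) →
        (a₁ ≡ a₂ × a₂ ≡ a₃ × Tri B b₁ b₂ b₃)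
      ⊎ (b₁ ≡ b₂ × b₂ ≡ b₃ × Tri A a₁ a₂ a₃)
      ⊎ (Tri A a₁ a₂ a₃ × Tri B b₁ b₂ b₃) } }

-- Size: |PG(k-1,2)| = 2^k − 1 ≡ 7 (mod 8), and 7 · 7 ≡ 1 (mod 8).
-- Pairedness is proved via "Fano pairs": two Fano subplanes through given points a, b,
-- parametrised by PG(2,2) with e₁ ↦ a, e₂ ↦ b, one having a point outside the other.
module Submission where

open import Defs
open import Data.Nat using (ℕ; _≤_; _%_)
open import Data.Product using (∃; ∃-syntax; _×_)
open import Relation.Binary.PropositionalEquality using (_≡_)

open import Level using (0ℓ)
open import Function using (_∘_; id)
open import Data.Nat using (zero; suc; _+_; _*_; _^_; _<_; z≤n; s≤s)
open import Data.Nat.Properties using (≤-trans; <-trans; m≤m+n; <⇒≱; 1+n≰n; *-comm; ^-distribˡ-+-*)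
open import Data.Nat.DivMod using ([m+kn]%n≡m%n; %-distribˡ-*)
open import Data.Bool using (Bool; true; false; _xor_; T)
open import Data.Bool.Properties using (T-irrelevant; xor-assoc; xor-comm; xor-identityˡ; xor-identityʳ; xor-same)
import Data.Bool.Properties as Bool
open import Data.Unit using (tt)
open import Data.Empty using (⊥-elim)
open import Data.Fin using (Fin; punchOut)
import Data.Fin as Fin
open import Data.Fin.Properties using (any?; ¬∀⟶∃¬; injective⇒≤; punchOut-injective; +↔⊎; *↔×; 2↔Bool)
open import Data.Vec using (Vec; []; _∷_; zipWith; replicate; uncons)
open import Data.Vec.Properties using (zipWith-assoc; zipWith-comm; zipWith-identityˡ; zipWith-identityʳ; ≡-dec)
open import Data.List using (List; []; _∷_; length; map; tabulate)
open import Data.List.Properties using (length-map; length-tabulate)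
open import Data.List.Relation.Unary.Any using (here; there; index)
open import Data.List.Membership.Propositional using (_∈_; _∉_)
open import Data.List.Membership.Propositional.Properties using (∈-map⁺; ∈-tabulate⁺)
open import Data.List.Membership.Setoid.Properties using (index-injective)
import Data.List.Membership.DecPropositional as DecMembership
open import Data.Product using (_,_; proj₁; proj₂; uncurry)
open import Data.Product.Function.NonDependent.Propositional using (_×-↔_)
open import Data.Sum using (_⊎_; inj₁; inj₂; [_,_]′)
open import Data.Sum.Function.Propositional using (_⊎-↔_)
open import Relation.Nullary using (¬_; yes; no; contradiction)
open import Relation.Nullary.Decidable using (map′)
open import Relation.Unary using (Pred; _⊆_)
open import Relation.Binary.Definitions using (DecidableEquality)
open import Relation.Binary.PropositionalEquality
  using (_≢_; refl; sym; trans; cong; cong₂; subst; subst₂; setoid; module ≡-Reasoning)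
open import Function.Bundles using (_↔_; _⇔_; mk⇔; mk↔ₛ′; Inverse; Equivalence)
open import Function.Definitions using (Injective)
open import Function.Construct.Composition using (_↔-∘_; _⇔-∘_)
open import Function.Construct.Symmetry using (↔-sym)

open Equivalence using (to; from)
open ≡-Reasoning

private
  variable
    A B C : TS
    d k n : ℕ

-- An injective map from Fin n to itself is onto: otherwise, composed with
-- punchOut, it would inject Fin n into Fin (n - 1).
Fin-injective⇒surjective : (f : Fin n → Fin n) → Injective _≡_ _≡_ f → ∀ j → ∃[ i ] f i ≡ j
Fin-injective⇒surjective {suc m} f f-injective j with any? (λ i → f i Fin.≟ j)
... | yes hit  = hit
... | no  miss = contradiction (injective⇒≤ {f = squeeze} squeeze-injective) 1+n≰n
  where
  avoids : ∀ i → j ≢ f i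
  avoids i j≡fi = miss (i , sym j≡fi)

  squeeze : Fin (suc m) → Fin m
  squeeze i = punchOut (avoids i)

  squeeze-injective : Injective _≡_ _≡_ squeeze
  squeeze-injective e = f-injective (punchOut-injective (avoids _) (avoids _) e)

module Finite {X : Set} (size : X ↔ Fin n) where
  open Inverse size renaming (to to index-of; from to element)

  element-injective : Injective _≡_ _≡_ element
  element-injective {i} {j} e =
    trans (sym (strictlyInverseˡ i)) (trans (cong index-of e) (strictlyInverseˡ j))

  index-of-injective : Injective _≡_ _≡_ index-of
  index-of-injective {x} {y} e =
    trans (sym (strictlyInverseʳ x)) (trans (cong element e) (strictlyInverseʳ y))

  finite-≟ : DecidableEquality X
  finite-≟ x y = map′ index-of-injective (cong index-of) (index-of x Fin.≟ index-of y)

  elements : List X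
  elements = tabulate element

  ∈-elements : ∀ x → x ∈ elements
  ∈-elements x = subst (_∈ elements) (strictlyInverseʳ x) (∈-tabulate⁺ (index-of x))

  length-elements : length elements ≡ n
  length-elements = length-tabulate element

  open DecMembership finite-≟ using (_∈?_)

  -- A list shorter than X misses some element: if it covered X, the positions of
  -- the elements in the list would inject Fin n into a smaller Fin.
  fresh : (L : List X) → length L < n → ∃[ w ] w ∉ L
  fresh L |L|<n =
    let (i , i∉L) = ¬∀⟶∃¬ n (λ i → element i ∈ L) (λ i → element i ∈? L) uncovering
    in element i , i∉L
    where
    uncovering : ¬ (∀ i → element i ∈ L)
    uncovering covered = <⇒≱ |L|<n (injective⇒≤ {f = position} position-injective)
      where
      position : Fin n → Fin (length L)
      position i = index (covered i)

      position-injective : Injective _≡_ _≡_ position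
      position-injective e = element-injective (index-injective (setoid X) (covered _) (covered _) e)

  injective⇒surjective : (f : X → X) → Injective _≡_ _≡_ f → ∀ y → ∃[ x ] f x ≡ y
  injective⇒surjective f f-injective y =
    let (i , e) = Fin-injective⇒surjective (index-of ∘ f ∘ element)
                    (element-injective ∘ f-injective ∘ index-of-injective) (index-of y)
    in element i , index-of-injective e

open Finite using (finite-≟; elements; ∈-elements; length-elements; fresh; injective⇒surjective)

pgSize : ℕ → ℕ
pgSize zero    = 0
pgSize (suc d) = pgSize d + 2 ^ d

uncons↔ : ∀ {X : Set} → Vec X (suc n) ↔ (X × Vec X n)
uncons↔ = mk↔ₛ′ uncons (uncurry _∷_) (λ _ → refl) (λ { (_ ∷ _) → refl })

bits↔Fin : ∀ d → Vec Bool d ↔ Fin (2 ^ d)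
bits↔Fin zero    = mk↔ₛ′ (λ _ → Fin.zero) (λ _ → []) (λ { Fin.zero → refl ; (Fin.suc ()) }) (λ { [] → refl })
bits↔Fin (suc d) = ↔-sym *↔× ↔-∘ ((↔-sym 2↔Bool ×-↔ bits↔Fin d) ↔-∘ uncons↔)

leading-bit↔ : PGPt (suc d) ↔ (PGPt d ⊎ Vec Bool d)
leading-bit↔ {d} = mk↔ₛ′ split join (λ { (inj₁ _) → refl ; (inj₂ _) → refl })
                                    (λ { ((false ∷ _) , _) → refl ; ((true ∷ _) , _) → refl })
  where
  split : PGPt (suc d) → PGPt d ⊎ Vec Bool d
  split ((false ∷ v) , v≢0) = inj₁ (v , v≢0)
  split ((true  ∷ v) , _)   = inj₂ v

  join : PGPt d ⊎ Vec Bool d → PGPt (suc d)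
  join (inj₁ (v , v≢0)) = (false ∷ v) , v≢0
  join (inj₂ v)         = (true ∷ v) , tt

points↔Fin : ∀ d → HasSize (PGV d) (pgSize d)
points↔Fin zero    = mk↔ₛ′ (λ { ([] , ()) }) (λ ()) (λ ()) (λ { ([] , ()) })
points↔Fin (suc d) = ↔-sym +↔⊎ ↔-∘ ((points↔Fin d ⊎-↔ bits↔Fin d) ↔-∘ leading-bit↔)

product-size : ∀ {m} → HasSize A n → HasSize B m → HasSize (A ⊗ B) (n * m)
product-size sizeA sizeB = ↔-sym *↔× ↔-∘ (sizeA ×-↔ sizeB)

-- |PG(d-1,2)| ≡ 7 (mod 8) for d ≥ 3, since each added term 2^d is divisible by 8.
pgSize-mod8 : ∀ m → pgSize (3 + m) % 8 ≡ 7
pgSize-mod8 zero    = refl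
pgSize-mod8 (suc m) = begin
  (pgSize (3 + m) + 2 ^ (3 + m)) % 8 ≡⟨ cong (λ t → (pgSize (3 + m) + t) % 8) 2^[3+m]≡2^m*8 ⟩
  (pgSize (3 + m) + 2 ^ m * 8) % 8   ≡⟨ [m+kn]%n≡m%n (pgSize (3 + m)) (2 ^ m) 8 ⟩
  pgSize (3 + m) % 8                 ≡⟨ pgSize-mod8 m ⟩
  7                                  ∎
  where
  2^[3+m]≡2^m*8 : 2 ^ (3 + m) ≡ 2 ^ m * 8
  2^[3+m]≡2^m*8 = trans (^-distribˡ-+-* 2 3 m) (*-comm 8 (2 ^ m))

7<pgSize : ∀ m → 7 < pgSize (4 + m)
7<pgSize zero    = m≤m+n 8 7
7<pgSize (suc m) = ≤-trans (7<pgSize m) (m≤m+n (pgSize (4 + m)) _)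

3<7 : 3 < 7
3<7 = m≤m+n 4 3

7·7≡1-mod8 : ∀ a b → a % 8 ≡ 7 → b % 8 ≡ 7 → (a * b) % 8 ≡ 1
7·7≡1-mod8 a b a≡7 b≡7 = begin
  (a * b) % 8               ≡⟨ %-distribˡ-* a b 8 ⟩
  ((a % 8) * (b % 8)) % 8   ≡⟨ cong₂ (λ s t → (s * t) % 8) a≡7 b≡7 ⟩
  (7 * 7) % 8               ≡⟨⟩
  1                         ∎

infixl 6 _⊕_

_⊕_ : Vec Bool d → Vec Bool d → Vec Bool d
_⊕_ = zipWith _xor_

𝟘 : Vec Bool d
𝟘 = replicate _ false

⊕-assoc : (u v w : Vec Bool d) → (u ⊕ v) ⊕ w ≡ u ⊕ (v ⊕ w)
⊕-assoc = zipWith-assoc xor-assoc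

⊕-comm : (u v : Vec Bool d) → u ⊕ v ≡ v ⊕ u
⊕-comm = zipWith-comm xor-comm

⊕-identityˡ : (u : Vec Bool d) → 𝟘 ⊕ u ≡ u
⊕-identityˡ = zipWith-identityˡ xor-identityˡ

⊕-identityʳ : (u : Vec Bool d) → u ⊕ 𝟘 ≡ u
⊕-identityʳ = zipWith-identityʳ xor-identityʳ

⊕-self : (u : Vec Bool d) → u ⊕ u ≡ 𝟘
⊕-self []      = refl
⊕-self (a ∷ u) = cong₂ _∷_ (xor-same a) (⊕-self u)

-- Every vector is its own negative, so u ⊕ v = 𝟘 forces u = v.
⊕≡𝟘⇒≡ : {u v : Vec Bool d} → u ⊕ v ≡ 𝟘 → u ≡ v
⊕≡𝟘⇒≡ {u = u} {v} u⊕v≡𝟘 = begin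
  u            ≡⟨ ⊕-identityʳ u ⟨
  u ⊕ 𝟘        ≡⟨ cong (u ⊕_) (⊕-self v) ⟨
  u ⊕ (v ⊕ v)  ≡⟨ ⊕-assoc u v v ⟨
  (u ⊕ v) ⊕ v  ≡⟨ cong (_⊕ v) u⊕v≡𝟘 ⟩
  𝟘 ⊕ v        ≡⟨ ⊕-identityˡ v ⟩
  v            ∎

⊕-interchange : (s t u v : Vec Bool d) → (s ⊕ t) ⊕ (u ⊕ v) ≡ (s ⊕ u) ⊕ (t ⊕ v)
⊕-interchange s t u v = begin
  (s ⊕ t) ⊕ (u ⊕ v)  ≡⟨ ⊕-assoc s t (u ⊕ v) ⟩
  s ⊕ (t ⊕ (u ⊕ v))  ≡⟨ cong (s ⊕_) (⊕-assoc t u v) ⟨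
  s ⊕ ((t ⊕ u) ⊕ v)  ≡⟨ cong (λ w → s ⊕ (w ⊕ v)) (⊕-comm t u) ⟩
  s ⊕ ((u ⊕ t) ⊕ v)  ≡⟨ cong (s ⊕_) (⊕-assoc u t v) ⟩
  s ⊕ (u ⊕ (t ⊕ v))  ≡⟨ ⊕-assoc s u (t ⊕ v) ⟨
  (s ⊕ u) ⊕ (t ⊕ v)  ∎

vec : PGPt d → Vec Bool d
vec = proj₁

anyTrue-𝟘 : ∀ d → anyTrue (𝟘 {d}) ≡ false
anyTrue-𝟘 zero    = refl
anyTrue-𝟘 (suc d) = anyTrue-𝟘 d

point≢𝟘 : (p : PGPt d) → vec p ≢ 𝟘
point≢𝟘 {d} (v , v-nonzero) refl = subst T (anyTrue-𝟘 d) v-nonzero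

≢𝟘⇒nonzero : {v : Vec Bool d} → v ≢ 𝟘 → T (anyTrue v)
≢𝟘⇒nonzero {v = []}        v≢𝟘 = v≢𝟘 refl
≢𝟘⇒nonzero {v = true  ∷ v} _   = tt
≢𝟘⇒nonzero {v = false ∷ v} v≢𝟘 = ≢𝟘⇒nonzero (v≢𝟘 ∘ cong (false ∷_))

-- A point is determined by its vector (nonzeroness is a proposition).
point-≡ : {p q : PGPt d} → vec p ≡ vec q → p ≡ q
point-≡ {p = v , s} {.v , t} refl = cong (v ,_) (T-irrelevant s t)

_≟ᴾ_ : DecidableEquality (PGPt d)
p ≟ᴾ q = map′ point-≡ (cong vec) (≡-dec Bool._≟_ (vec p) (vec q))

third : (p q : PGPt d) → p ≢ q → PGPt d
third p q p≢q = vec p ⊕ vec q , ≢𝟘⇒nonzero (λ e → p≢q (point-≡ (⊕≡𝟘⇒≡ e)))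

PGTri-unique : ∀ {p q r r′ : PGPt d} → PGTri d p q r → PGTri d p q r′ → r ≡ r′
PGTri-unique (_ , p⊕q≡r) (_ , p⊕q≡r′) = point-≡ (trans (sym p⊕q≡r) p⊕q≡r′)

Irreflexive : TS → Set
Irreflexive A = ∀ a c → ¬ Tri A a a c

PGV-irreflexive : ∀ d → Irreflexive (PGV d)
PGV-irreflexive d p r (p≢p , _) = p≢p refl

NonCollinear : (A : TS) → Pt A → Pt A → Pt A → Set
NonCollinear A a b c = a ≢ b × c ≢ a × c ≢ b × ¬ Tri A a b c

Image : {Z X : Set} → (Z → X) → Pred X 0ℓ
Image ι x = ∃[ p ] ι p ≡ x

record IsSubsystemEmbedding (B A : TS) (ι : Pt B → Pt A) : Set where
  field
    injective : Injective _≡_ _≡_ ι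
    triples   : ∀ p q r → Tri B p q r ⇔ Tri A (ι p) (ι q) (ι r)
    closed    : ∀ p q c → Tri A (ι p) (ι q) c → Image ι c

  completion : ∀ p q c → Tri A (ι p) (ι q) c → ∃[ r ] (ι r ≡ c × Tri B p q r)
  completion p q c t =
    let (r , ιr≡c) = closed p q c t
    in r , ιr≡c , from (triples p q r) (subst (Tri A (ι p) (ι q)) (sym ιr≡c) t)

open IsSubsystemEmbedding

image-subsystem : ∀ {ι} → IsSubsystemEmbedding B A ι → IsSubsystem A (Image ι)
image-subsystem emb a b c (p , refl) (q , refl) t = closed emb p q c t

∘-embedding : ∀ {ι κ} → IsSubsystemEmbedding B C ι → IsSubsystemEmbedding A B κ →
              IsSubsystemEmbedding A C (ι ∘ κ)
∘-embedding {ι = ι} {κ} ι-emb κ-emb = record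
  { injective = injective κ-emb ∘ injective ι-emb
  ; triples   = λ p q r → triples ι-emb (κ p) (κ q) (κ r) ⇔-∘ triples κ-emb p q r
  ; closed    = λ p q c t →
      let (r , ιr≡c , t′) = completion ι-emb (κ p) (κ q) c t
          (s , κs≡r)      = closed κ-emb p q r t′
      in s , trans (cong ι κs≡r) ιr≡c
  }

embedding⇒PG-subsystem : ∀ {g} → IsSubsystemEmbedding (PG k) A g → IsPGSubsystem A (Image g) k
embedding⇒PG-subsystem {g = g} emb =
  image-subsystem emb , g , (λ p q → injective emb) , (λ x → mk⇔ id id) , triples emb

PG-subsystem⇒embedding : ∀ {S} → IsPGSubsystem A S k →
  ∃[ g ] (IsSubsystemEmbedding (PG k) A g × (∀ x → S x ⇔ Image g x))
PG-subsystem⇒embedding {A = A} {k = k} (sub , g , g-injective , mem , g-triples) = g , emb , mem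
  where
  emb : IsSubsystemEmbedding (PG k) A g
  emb = record
    { injective = g-injective _ _
    ; triples   = g-triples
    ; closed    = λ p q c t →
        to (mem c) (sub _ _ c (from (mem _) (p , refl)) (from (mem _) (q , refl)) t)
    }

noncollinear-reflect : ∀ {ι p q r} → IsSubsystemEmbedding B A ι →
  NonCollinear A (ι p) (ι q) (ι r) → NonCollinear B p q r
noncollinear-reflect {ι = ι} {p} {q} {r} emb (ιp≢ιq , ιr≢ιp , ιr≢ιq , ¬t) =
  ιp≢ιq ∘ cong ι , ιr≢ιp ∘ cong ι , ιr≢ιq ∘ cong ι , ¬t ∘ to (triples emb p q r)

noncollinear-preserve : ∀ {ι p q r} → IsSubsystemEmbedding B A ι →
  NonCollinear B p q r → NonCollinear A (ι p) (ι q) (ι r)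
noncollinear-preserve {p = p} {q} {r} emb (p≢q , r≢p , r≢q , ¬t) =
  p≢q ∘ injective emb , r≢p ∘ injective emb , r≢q ∘ injective emb , ¬t ∘ from (triples emb p q r)

off-image-noncollinear : ∀ {ι p q a b w} → IsSubsystemEmbedding B A ι → ι p ≡ a → ι q ≡ b → a ≢ b →
  (∀ s → ι s ≢ w) → NonCollinear A a b w
off-image-noncollinear {p = p} {q} {w = w} emb refl refl a≢b outside =
  a≢b , outside p ∘ sym , outside q ∘ sym ,
  λ t → let (s , ιs≡w) = closed emb p q w t in outside s ιs≡w

e₁ e₂ e₃ : PGPt 3
e₁ = (true ∷ false ∷ false ∷ []) , tt
e₂ = (false ∷ true ∷ false ∷ []) , tt
e₃ = (false ∷ false ∷ true ∷ []) , tt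

scale : Bool → Vec Bool d → Vec Bool d
scale false v = 𝟘
scale true  v = v

scale-xor : ∀ a b (v : Vec Bool d) → scale (a xor b) v ≡ scale a v ⊕ scale b v
scale-xor false false v = sym (⊕-identityˡ 𝟘)
scale-xor false true  v = sym (⊕-identityˡ v)
scale-xor true  false v = sym (⊕-identityʳ v)
scale-xor true  true  v = sym (⊕-self v)

combination : Vec Bool d → Vec Bool d → Vec Bool d → Vec Bool 3 → Vec Bool d
combination u v w (a ∷ b ∷ c ∷ []) = (scale a u ⊕ scale b v) ⊕ scale c w

combination-⊕ : (u v w : Vec Bool d) (x y : Vec Bool 3) →
  combination u v w (x ⊕ y) ≡ combination u v w x ⊕ combination u v w y
combination-⊕ u v w (a ∷ b ∷ c ∷ []) (a′ ∷ b′ ∷ c′ ∷ []) =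
  trans (cong₂ _⊕_ (cong₂ _⊕_ (scale-xor a a′ u) (scale-xor b b′ v)) (scale-xor c c′ w))
        (trans (cong (_⊕ (scale c w ⊕ scale c′ w)) (⊕-interchange _ _ _ _))
               (⊕-interchange _ _ _ _))

module Frame {p q r : PGPt d} (nc : NonCollinear (PGV d) p q r) where
  private
    p≢q : p ≢ q
    p≢q = proj₁ nc

    r≢p : r ≢ p
    r≢p = proj₁ (proj₂ nc)

    r≢q : r ≢ q
    r≢q = proj₁ (proj₂ (proj₂ nc))

    ¬pqr : ¬ PGTri d p q r
    ¬pqr = proj₂ (proj₂ (proj₂ nc))

  combine : Vec Bool 3 → Vec Bool d
  combine = combination (vec p) (vec q) (vec r)

  pair-independent : ∀ a b → scale a (vec p) ⊕ scale b (vec q) ≡ 𝟘 → a ≡ false × b ≡ false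
  pair-independent false false _ = refl , refl
  pair-independent true  false e = ⊥-elim (point≢𝟘 p (trans (sym (⊕-identityʳ _)) e))
  pair-independent false true  e = ⊥-elim (point≢𝟘 q (trans (sym (⊕-identityˡ _)) e))
  pair-independent true  true  e = ⊥-elim (p≢q (point-≡ (⊕≡𝟘⇒≡ e)))

  r-off-span : ∀ a b → scale a (vec p) ⊕ scale b (vec q) ≢ vec r
  r-off-span false false e = point≢𝟘 r (trans (sym e) (⊕-identityˡ 𝟘))
  r-off-span true  false e = r≢p (point-≡ (trans (sym e) (⊕-identityʳ _)))
  r-off-span false true  e = r≢q (point-≡ (trans (sym e) (⊕-identityˡ _)))
  r-off-span true  true  e = ¬pqr (p≢q ∘ point-≡ , e)

  kernel-trivial : ∀ x → combine x ≡ 𝟘 → x ≡ 𝟘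
  kernel-trivial (a ∷ b ∷ true  ∷ []) e = ⊥-elim (r-off-span a b (⊕≡𝟘⇒≡ e))
  kernel-trivial (a ∷ b ∷ false ∷ []) e with pair-independent a b (trans (sym (⊕-identityʳ _)) e)
  ... | refl , refl = refl

  combine-injective : Injective _≡_ _≡_ combine
  combine-injective {x} {y} e = ⊕≡𝟘⇒≡ (kernel-trivial (x ⊕ y) (begin
    combine (x ⊕ y)            ≡⟨ combination-⊕ _ _ _ x y ⟩
    combine x ⊕ combine y      ≡⟨ cong (_⊕ combine y) e ⟩
    combine y ⊕ combine y      ≡⟨ ⊕-self _ ⟩
    𝟘                          ∎))

  frame : PGPt 3 → PGPt d
  frame x = combine (vec x) , ≢𝟘⇒nonzero (point≢𝟘 x ∘ kernel-trivial (vec x))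

  -- Linear injective maps preserve and reflect triples {x, y, x + y}, and the
  -- image is closed under addition.
  frame-embedding : IsSubsystemEmbedding (PGV 3) (PGV d) frame
  frame-embedding = record
    { injective = point-≡ ∘ combine-injective ∘ cong vec
    ; triples   = λ x y z → mk⇔
        (λ (x≢y , x⊕y≡z) → x≢y ∘ combine-injective ,
                            trans (sym (combination-⊕ _ _ _ (vec x) (vec y))) (cong combine x⊕y≡z))
        (λ (fx≢fy , fx⊕fy≡fz) → fx≢fy ∘ cong combine ,
                                combine-injective (trans (combination-⊕ _ _ _ (vec x) (vec y)) fx⊕fy≡fz))
    ; closed    = λ x y c (fx≢fy , fx⊕fy≡c) →
        third x y (fx≢fy ∘ cong (vec ∘ frame)) ,
        point-≡ (trans (combination-⊕ _ _ _ (vec x) (vec y)) fx⊕fy≡c)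
    }

  frame-e₁ : frame e₁ ≡ p
  frame-e₁ = point-≡ (trans (⊕-identityʳ _) (⊕-identityʳ (vec p)))

  frame-e₂ : frame e₂ ≡ q
  frame-e₂ = point-≡ (trans (⊕-identityʳ _) (⊕-identityˡ (vec q)))

  frame-e₃ : frame e₃ ≡ r
  frame-e₃ = point-≡ (trans (cong (_⊕ vec r) (⊕-identityˡ 𝟘)) (⊕-identityˡ (vec r)))

open Frame using (frame; frame-embedding; frame-e₁; frame-e₂; frame-e₃)

noncollinear-exists : HasSize (PGV d) n → 3 < n → ∀ {p q} → p ≢ q → ∃[ r ] NonCollinear (PGV d) p q r
noncollinear-exists size 3<n {p} {q} p≢q =
  let (r , r∉) = fresh size (p ∷ q ∷ third p q p≢q ∷ []) 3<n
  in r , p≢q , r∉ ∘ here , r∉ ∘ there ∘ here ,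
     λ (_ , p⊕q≡r) → r∉ (there (there (here (point-≡ (sym p⊕q≡r)))))

outside-fano : ∀ {X : Set} → X ↔ Fin n → 7 < n → (f : PGPt 3 → X) → ∃[ w ] (∀ p → f p ≢ w)
outside-fano {n} {X} size 7<n f =
  let (w , w∉) = fresh size plane |plane|<n
  in w , λ p fp≡w → w∉ (subst (_∈ plane) fp≡w (∈-map⁺ f (∈-elements fano p)))
  where
  fano : HasSize (PGV 3) 7
  fano = points↔Fin 3

  plane : List X
  plane = map f (elements fano)

  |plane|<n : length plane < n
  |plane|<n = subst (_< n) (sym (trans (length-map f (elements fano)) (length-elements fano))) 7<n

-- A subsystem containing the images of e₁, e₂, e₃ under a Fano embedding
-- contains the whole plane: the other four points are sums of these.
standard-frame-spans : ∀ {g S} → IsSubsystemEmbedding (PGV 3) A g → IsSubsystem A S →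
  S (g e₁) → S (g e₂) → S (g e₃) → ∀ x → S (g x)
standard-frame-spans {g = g} {S} emb sub s₁ s₂ s₃ = spans
  where
  join : ∀ u v w → PGTri 3 u v w → S (g u) → S (g v) → S (g w)
  join u v w t su sv = sub _ _ _ su sv (to (triples emb u v w) t)

  e₁₂ : PGPt 3
  e₁₂ = (true ∷ true ∷ false ∷ []) , tt

  spans : ∀ x → S (g x)
  spans ((false ∷ false ∷ false ∷ []) , ())
  spans ((true  ∷ false ∷ false ∷ []) , _) = s₁
  spans ((false ∷ true  ∷ false ∷ []) , _) = s₂
  spans ((false ∷ false ∷ true  ∷ []) , _) = s₃
  spans ((true  ∷ true  ∷ false ∷ []) , _) = join e₁ e₂ _ ((λ ()) , refl) s₁ s₂
  spans ((true  ∷ false ∷ true  ∷ []) , _) = join e₁ e₃ _ ((λ ()) , refl) s₁ s₃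
  spans ((false ∷ true  ∷ true  ∷ []) , _) = join e₂ e₃ _ ((λ ()) , refl) s₂ s₃
  spans ((true  ∷ true  ∷ true  ∷ []) , _) =
    join e₁₂ e₃ _ ((λ ()) , refl) (join e₁ e₂ e₁₂ ((λ ()) , refl) s₁ s₂) s₃

-- Any three non-collinear points of a Fano subsystem generate it: the frame
-- map of their preimages is a bijection of PG(2,2).
fano-in-subsystem : ∀ {g S a b c} → IsSubsystemEmbedding (PGV 3) A g → IsSubsystem A S →
  NonCollinear A a b c → Image g a → Image g b → Image g c → S a → S b → S c → ∀ x → S (g x)
fano-in-subsystem {g = g} {S} emb sub nc (p , refl) (q , refl) (r , refl) sa sb sc x =
  let (s , frame-s≡x) = injective⇒surjective (points↔Fin 3) (frame nc′) (injective (frame-embedding nc′)) x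
  in subst (S ∘ g) frame-s≡x (spanned s)
  where
  nc′ : NonCollinear (PGV 3) p q r
  nc′ = noncollinear-reflect emb nc

  spanned : ∀ s → S (g (frame nc′ s))
  spanned = standard-frame-spans (∘-embedding emb (frame-embedding nc′)) sub
              (subst (S ∘ g) (sym (frame-e₁ nc′)) sa)
              (subst (S ∘ g) (sym (frame-e₂ nc′)) sb)
              (subst (S ∘ g) (sym (frame-e₃ nc′)) sc)

third-generator : ∀ {g a b} → IsSubsystemEmbedding (PGV 3) A g → Image g a → Image g b → a ≢ b →
  ∃[ c ] (Image g c × NonCollinear A a b c)
third-generator {g = g} emb (p , refl) (q , refl) a≢b =
  let (r , nc) = noncollinear-exists (points↔Fin 3) 3<7 (a≢b ∘ cong g)
  in g r , (r , refl) , noncollinear-preserve emb nc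

record FanoPair (A : TS) (a b : Pt A) : Set where
  field
    plane₁ plane₂ : PGPt 3 → Pt A
    plane₁-embedding : IsSubsystemEmbedding (PGV 3) A plane₁
    plane₂-embedding : IsSubsystemEmbedding (PGV 3) A plane₂
    plane₁-e₁ : plane₁ e₁ ≡ a
    plane₁-e₂ : plane₁ e₂ ≡ b
    plane₂-e₁ : plane₂ e₁ ≡ a
    plane₂-e₂ : plane₂ e₂ ≡ b
    witness   : PGPt 3
    separated : ∀ q → plane₂ q ≢ plane₁ witness

FanoPaired : TS → Set
FanoPaired A = ∀ a b → a ≢ b → FanoPair A a b

FanoPaired⇒PG22Paired : FanoPaired A → PG22Paired A
FanoPaired⇒PG22Paired paired a b a≢b =
  Image plane₁ , Image plane₂ ,
  embedding⇒PG-subsystem plane₁-embedding , embedding⇒PG-subsystem plane₂-embedding ,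
  (e₁ , plane₁-e₁) , (e₂ , plane₁-e₂) , (e₁ , plane₂-e₁) , (e₂ , plane₂-e₂) ,
  plane₁ witness , inj₁ ((witness , refl) , λ (q , e) → separated q e)
  where open FanoPair (paired a b a≢b)

FanoPair-transport : ∀ {ι b b′} → IsSubsystemEmbedding B A ι → FanoPair B b b′ → FanoPair A (ι b) (ι b′)
FanoPair-transport {ι = ι} emb P = record
  { plane₁           = ι ∘ plane₁
  ; plane₂           = ι ∘ plane₂
  ; plane₁-embedding = ∘-embedding emb plane₁-embedding
  ; plane₂-embedding = ∘-embedding emb plane₂-embedding
  ; plane₁-e₁        = cong ι plane₁-e₁
  ; plane₁-e₂        = cong ι plane₁-e₂
  ; plane₂-e₁        = cong ι plane₂-e₁
  ; plane₂-e₂        = cong ι plane₂-e₂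
  ; witness          = witness
  ; separated        = λ q → separated q ∘ injective emb
  }
  where open FanoPair P

frames-FanoPair : ∀ {a b r₁ r₂ : PGPt d} (nc₁ : NonCollinear (PGV d) a b r₁) →
  (∀ s → frame nc₁ s ≢ r₂) → FanoPair (PGV d) a b
frames-FanoPair {a = a} {b} {r₂ = r₂} nc₁ off-plane = record
  { plane₁           = frame nc₂
  ; plane₂           = frame nc₁
  ; plane₁-embedding = frame-embedding nc₂
  ; plane₂-embedding = frame-embedding nc₁
  ; plane₁-e₁        = frame-e₁ nc₂
  ; plane₁-e₂        = frame-e₂ nc₂
  ; plane₂-e₁        = frame-e₁ nc₁
  ; plane₂-e₂        = frame-e₂ nc₁
  ; witness          = e₃
  ; separated        = λ s e → off-plane s (trans e (frame-e₃ nc₂))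
  }
  where
  nc₂ : NonCollinear (PGV _) a b r₂
  nc₂ = off-image-noncollinear {p = e₁} {q = e₂} (frame-embedding nc₁) (frame-e₁ nc₁) (frame-e₂ nc₁)
          (proj₁ nc₁) off-plane

-- PG(d-1,2) with d ≥ 4 is Fano-paired: take r₁ off the line ab, and r₂ off the
-- plane ⟨a,b,r₁⟩, which exists as PG(d-1,2) has more than seven points.
PG-FanoPaired : ∀ m → FanoPaired (PGV (4 + m))
PG-FanoPaired m a b a≢b =
  let (r₁ , nc₁)       = noncollinear-exists size (<-trans 3<7 (7<pgSize m)) a≢b
      (r₂ , off-plane) = outside-fano size (7<pgSize m) (frame nc₁)
  in frames-FanoPair nc₁ off-plane
  where
  size : HasSize (PGV (4 + m)) (pgSize (4 + m))
  size = points↔Fin (4 + m)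

fibre-triple : ∀ {a p q c} → Irreflexive A → Tri (A ⊗ B) (a , p) (a , q) c → a ≡ proj₁ c × Tri B p q (proj₂ c)
fibre-triple irr (inj₁ (_ , a≡c , t))       = a≡c , t
fibre-triple irr (inj₂ (inj₁ (_ , _ , t))) = ⊥-elim (irr _ _ t)
fibre-triple irr (inj₂ (inj₂ (t , _)))     = ⊥-elim (irr _ _ t)

fibre-tripleʳ : ∀ {b p q c} → Irreflexive B → Tri (A ⊗ B) (p , b) (q , b) c → b ≡ proj₂ c × Tri A p q (proj₁ c)
fibre-tripleʳ irr (inj₁ (_ , _ , t))        = ⊥-elim (irr _ _ t)
fibre-tripleʳ irr (inj₂ (inj₁ (_ , b≡c , t))) = b≡c , t
fibre-tripleʳ irr (inj₂ (inj₂ (_ , t)))     = ⊥-elim (irr _ _ t)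

fibre-embedding : Irreflexive A → (a : Pt A) → IsSubsystemEmbedding B (A ⊗ B) (a ,_)
fibre-embedding {A = A} {B = B} irr a = record
  { injective = cong proj₂
  ; triples   = λ p q r → mk⇔ (λ t → inj₁ (refl , refl , t)) (proj₂ ∘ fibre-triple {A = A} {B = B} irr)
  ; closed    = λ p q c t → proj₂ c , cong (_, proj₂ c) (proj₁ (fibre-triple {A = A} {B = B} irr t))
  }

fibre-embeddingʳ : Irreflexive B → (b : Pt B) → IsSubsystemEmbedding A (A ⊗ B) (_, b)
fibre-embeddingʳ {B = B} {A = A} irr b = record
  { injective = cong proj₁
  ; triples   = λ p q r → mk⇔ (λ t → inj₂ (inj₁ (refl , refl , t))) (proj₂ ∘ fibre-tripleʳ {B = B} {A = A} irr)
  ; closed    = λ p q c t → proj₁ c , cong (proj₁ c ,_) (proj₁ (fibre-tripleʳ {B = B} {A = A} irr t))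
  }

graph-embedding : ∀ {g h} → Irreflexive A → Irreflexive B →
  IsSubsystemEmbedding (PGV d) A g → IsSubsystemEmbedding (PGV d) B h →
  IsSubsystemEmbedding (PGV d) (A ⊗ B) (λ p → g p , h p)
graph-embedding {A = A} {B = B} {g = g} {h} irrA irrB g-emb h-emb = record
  { injective = injective g-emb ∘ cong proj₁
  ; triples   = λ p q r → mk⇔ (λ t → inj₂ (inj₂ (to (triples g-emb p q r) t , to (triples h-emb p q r) t)))
                              (from (triples g-emb p q r) ∘ proj₁ ∘ graph-triple)
  ; closed    = λ p q c t →
      let (tA , tB)            = graph-triple t
          (r₁ , gr₁≡c₁ , t₁) = completion g-emb p q (proj₁ c) tA
          (r₂ , hr₂≡c₂ , t₂) = completion h-emb p q (proj₂ c) tB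
      in r₁ , cong₂ _,_ gr₁≡c₁ (trans (cong h (PGTri-unique {p = p} {q} {r₁} {r₂} t₁ t₂)) hr₂≡c₂)
  }
  where
  -- Distinct graph points differ in both coordinates, so only "diagonal" triples occur.
  graph-triple : ∀ {p q c} → Tri (A ⊗ B) (g p , h p) (g q , h q) c →
                 Tri A (g p) (g q) (proj₁ c) × Tri B (h p) (h q) (proj₂ c)
  graph-triple {q = q} {c} (inj₁ (gp≡gq , _ , t)) =
    ⊥-elim (irrB _ _ (subst (λ s → Tri B (h s) (h q) (proj₂ c)) (injective g-emb gp≡gq) t))
  graph-triple {q = q} {c} (inj₂ (inj₁ (hp≡hq , _ , t))) =
    ⊥-elim (irrA _ _ (subst (λ s → Tri A (g s) (g q) (proj₁ c)) (injective h-emb hp≡hq) t))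
  graph-triple (inj₂ (inj₂ tAB)) = tAB

-- Fano pairs through (a,b), (a′,b′) with a ≠ a′, b ≠ b′: graphs of the two planes
-- through a, a′ against one plane through b, b′.
graph-FanoPair : ∀ {a a′ b b′} → Irreflexive A → Irreflexive B →
  FanoPair A a a′ → FanoPair B b b′ → FanoPair (A ⊗ B) (a , b) (a′ , b′)
graph-FanoPair irrA irrB P Q = record
  { plane₁           = λ s → P.plane₁ s , Q.plane₁ s
  ; plane₂           = λ s → P.plane₂ s , Q.plane₁ s
  ; plane₁-embedding = graph-embedding irrA irrB P.plane₁-embedding Q.plane₁-embedding
  ; plane₂-embedding = graph-embedding irrA irrB P.plane₂-embedding Q.plane₁-embedding
  ; plane₁-e₁        = cong₂ _,_ P.plane₁-e₁ Q.plane₁-e₁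
  ; plane₁-e₂        = cong₂ _,_ P.plane₁-e₂ Q.plane₁-e₂
  ; plane₂-e₁        = cong₂ _,_ P.plane₂-e₁ Q.plane₁-e₁
  ; plane₂-e₂        = cong₂ _,_ P.plane₂-e₂ Q.plane₁-e₂
  ; witness          = P.witness
  ; separated        = λ s → P.separated s ∘ cong proj₁
  }
  where
  module P = FanoPair P
  module Q = FanoPair Q

product-FanoPaired : Irreflexive A → Irreflexive B →
  DecidableEquality (Pt A) → DecidableEquality (Pt B) →
  FanoPaired A → FanoPaired B → FanoPaired (A ⊗ B)
product-FanoPaired irrA irrB _≟A_ _≟B_ pairedA pairedB (a , b) (a′ , b′) ne
  with a ≟A a′ | b ≟B b′
... | yes refl | _        = FanoPair-transport (fibre-embedding irrA a) (pairedB b b′ (ne ∘ cong (a ,_)))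
... | no a≢a′  | yes refl = FanoPair-transport (fibre-embeddingʳ irrB b) (pairedA a a′ a≢a′)
... | no a≢a′  | no b≢b′  = graph-FanoPair irrA irrB (pairedA a a′ a≢a′) (pairedB b b′ b≢b′)

InPG : (Y : TS) → ℕ → Pred (Pt Y) 0ℓ → Set
InPG Y k P = ∃[ g ] (IsSubsystemEmbedding (PG k) Y g × P ⊆ Image g)

generated⇒InPG : ∀ {Y P} → GeneratesPG Y P k → InPG Y k P
generated⇒InPG (S , (_ , P⊆S , _) , pg) =
  let (g , emb , mem) = PG-subsystem⇒embedding pg in g , emb , to (mem _) ∘ P⊆S

pattern at-x = inj₁ refl
pattern at-y = inj₂ (inj₁ refl)
pattern at-u = inj₂ (inj₂ (inj₁ refl))
pattern at-v = inj₂ (inj₂ (inj₂ refl))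

module TwoPointed {Y : TS} (size : HasSize Y n) (7<n : 7 < n) {x y : Pt Y} (x≢y : x ≢ y)
  (generates : ∀ u v → u ≢ x → u ≢ y → v ≢ x → v ≢ y → u ≢ v →
                 GeneratesPG Y (Four x y u v) 2 ⊎ GeneratesPG Y (Four x y u v) 3) where

  -- Given a Fano subsystem g through x, y, a point c of it off the line xy and a point w
  -- outside it: a Fano plane through x, y, c, w would lie inside g, so x, y, c, w
  -- generate a PG(3,2), which then contains the whole of g.
  extend-fano : ∀ {g c w} → IsSubsystemEmbedding (PG 2) Y g → Image g x → Image g y → Image g c →
    NonCollinear Y x y c → (∀ p → g p ≢ w) → InPG Y 3 (Image g)
  extend-fano {g} {c} {w} emb gx gy gc nc@(_ , c≢x , c≢y , _) outside =
    [ no-fano , contains-g ]′ (generates c w c≢x c≢y (avoids gx) (avoids gy) (avoids gc ∘ sym))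
    where
    avoids : ∀ {z} → Image g z → w ≢ z
    avoids (p , gp≡z) w≡z = outside p (trans gp≡z (sym w≡z))

    no-fano : GeneratesPG Y (Four x y c w) 2 → InPG Y 3 (Image g)
    no-fano fano =
      let (g′ , emb′ , four⊆) = generated⇒InPG fano
          (qw , g′qw≡w)       = four⊆ at-v
          g′⊆g = fano-in-subsystem emb′ (image-subsystem emb) nc
                   (four⊆ at-x) (four⊆ at-y) (four⊆ at-u) gx gy gc
      in ⊥-elim (avoids (subst (Image g) g′qw≡w (g′⊆g qw)) refl)

    contains-g : GeneratesPG Y (Four x y c w) 3 → InPG Y 3 (Image g)
    contains-g solid =
      let (g′ , emb′ , four⊆) = generated⇒InPG solid
          g⊆g′ = fano-in-subsystem emb (image-subsystem emb′) nc
                   gx gy gc (four⊆ at-x) (four⊆ at-y) (four⊆ at-u)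
      in g′ , emb′ , λ { (p , refl) → g⊆g′ p }

  fano-extends : ∀ {g} → IsSubsystemEmbedding (PG 2) Y g → Image g x → Image g y → InPG Y 3 (Image g)
  fano-extends {g} emb gx gy =
    let (c , gc , nc) = third-generator emb gx gy x≢y
        (w , outside) = outside-fano size 7<n g
    in extend-fano emb gx gy gc nc outside

  quadruple-in-PG3 : ∀ {u v} → u ≢ x → u ≢ y → v ≢ x → v ≢ y → u ≢ v → InPG Y 3 (Four x y u v)
  quadruple-in-PG3 {u} {v} u≢x u≢y v≢x v≢y u≢v =
    [ via-fano , generated⇒InPG ]′ (generates u v u≢x u≢y v≢x v≢y u≢v)
    where
    via-fano : GeneratesPG Y (Four x y u v) 2 → InPG Y 3 (Four x y u v)
    via-fano fano =
      let (g , emb , four⊆)   = generated⇒InPG fano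
          (g′ , emb′ , g⊆g′) = fano-extends emb (four⊆ at-x) (four⊆ at-y)
      in g′ , emb′ , g⊆g′ ∘ four⊆

  Generic : Pt Y → Set
  Generic u = u ≢ x × u ≢ y

  classify : ∀ a → (a ≡ x ⊎ a ≡ y) ⊎ Generic a
  classify a with finite-≟ size a x | finite-≟ size a y
  ... | yes a≡x | _       = inj₁ (inj₁ a≡x)
  ... | no  a≢x | yes a≡y = inj₁ (inj₂ a≡y)
  ... | no  a≢x | no  a≢y = inj₂ (a≢x , a≢y)

  fresh-generic : ∀ z → ∃[ v ] (Generic v × z ≢ v)
  fresh-generic z =
    let (v , v∉) = fresh size (x ∷ y ∷ z ∷ []) (<-trans 3<7 7<n)
    in v , (v∉ ∘ here , v∉ ∘ there ∘ here) , v∉ ∘ there ∘ there ∘ here ∘ sym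

  among-xy : ∀ {a u v} → a ≡ x ⊎ a ≡ y → Four x y u v a
  among-xy (inj₁ a≡x) = inj₁ a≡x
  among-xy (inj₂ a≡y) = inj₂ (inj₁ a≡y)

  quadruple-through : ∀ a b → a ≢ b →
    ∃[ u ] ∃[ v ] (Generic u × Generic v × u ≢ v × Four x y u v a × Four x y u v b)
  quadruple-through a b a≢b with classify a | classify b
  ... | inj₂ ga | inj₂ gb = a , b , ga , gb , a≢b , at-u , at-v
  ... | inj₂ ga | inj₁ b∈ =
    let (v , gv , a≢v) = fresh-generic a in a , v , ga , gv , a≢v , at-u , among-xy b∈
  ... | inj₁ a∈ | inj₂ gb =
    let (v , gv , b≢v) = fresh-generic b in b , v , gb , gv , b≢v , among-xy a∈ , at-u
  ... | inj₁ a∈ | inj₁ b∈ =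
    let (u , gu , _)   = fresh-generic x
        (v , gv , u≢v) = fresh-generic u
    in u , v , gu , gv , u≢v , among-xy a∈ , among-xy b∈

  pair-in-PG3 : ∀ a b → a ≢ b → ∃[ g ] (IsSubsystemEmbedding (PG 3) Y g × Image g a × Image g b)
  pair-in-PG3 a b a≢b =
    let (u , v , (u≢x , u≢y) , (v≢x , v≢y) , u≢v , a∈ , b∈) = quadruple-through a b a≢b
        (g , emb , four⊆) = quadruple-in-PG3 u≢x u≢y v≢x v≢y u≢v
    in g , emb , four⊆ a∈ , four⊆ b∈

  -- Hence Y is Fano-paired, since PG(3,2) is.
  fano-paired : FanoPaired Y
  fano-paired a b a≢b =
    let (g , emb , (pa , ga≡a) , (pb , gb≡b)) = pair-in-PG3 a b a≢b
        pa≢pb = λ pa≡pb → a≢b (trans (sym ga≡a) (trans (cong g pa≡pb) gb≡b))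
    in subst₂ (FanoPair Y) ga≡a gb≡b (FanoPair-transport emb (PG-FanoPaired 0 pa pb pa≢pb))

lemma2p3 : (Y₁ : TS) → IsSTS Y₁ →
    (∃[ x ] ∃[ y ] PG32TwoPointedWrt Y₁ x y) →
    (n₁ : ℕ) → HasSize Y₁ n₁ → n₁ % 8 ≡ 7 →
    (k : ℕ) → 4 ≤ k →
    (∃[ N ] (HasSize (Y₁ ⊗ PGV k) N × N % 8 ≡ 1)) ×
    PG22Paired Y₁ × PG22Paired (Y₁ ⊗ PGV k)
-- Matching on 4 ≤ k writes k = 4 + m; Y₁ is Fano-paired by the 2-pointed property,
-- PG(k-1,2) by k ≥ 4, and hence so is their product.
lemma2p3 Y₁ sts (x , y , (n , size , 7<n) , x≢y , generates) n₁ size₁ n₁≡7 k (s≤s (s≤s (s≤s (s≤s (z≤n {m}))))) =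
  (n₁ * pgSize k , product-size {A = Y₁} {B = PGV k} size₁ (points↔Fin k) , size-mod8) ,
  FanoPaired⇒PG22Paired paired₁ ,
  FanoPaired⇒PG22Paired
    (product-FanoPaired irreflexive₁ (PGV-irreflexive k) (finite-≟ size₁) _≟ᴾ_ paired₁ (PG-FanoPaired m))
  where
  size-mod8 : (n₁ * pgSize k) % 8 ≡ 1
  size-mod8 = 7·7≡1-mod8 n₁ (pgSize k) n₁≡7 (pgSize-mod8 (suc m))

  paired₁ : FanoPaired Y₁
  paired₁ = TwoPointed.fano-paired size 7<n x≢y generates

  irreflexive₁ : Irreflexive Y₁
  irreflexive₁ a c t = IsSTS.distinct sts a a c t refl
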